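{- For an ideal $\mathcal{I}$ on $\omega$, the following are equivalent: (1) Player I has a winning strategy in the HMM game with respect to $\mathcal{I}$; (2) Player II has a winning strategy in the tallness game with respect to $\mathcal{I}$; (3) $\mathcal{ED}_{\mathrm{fin}} \le_{\mathrm{KB}} \mathcal{I}$.
   Context: As usual, ideals on $\omega$ are assumed to contain all finite subsets of $\omega$ and not to contain $\omega$. Tallness game with respect to $\mathcal{I}$: in round $k$ Player I plays $n_k \in \omega$, subject to $n_0 < n_1 < \cdots$, then Player II plays $i_k \in \{0,1\}$; Player II wins iff $\{n_k : k\in\omega, i_k = 1\}$ is an infinite member of $\mathcal{I}$. HMM game with respect to $\mathcal{I}$: in round $k$ Player I plays a finite set $F_k \subseteq \omega$, then Player II plays $n_k \in \omega \setminus F_k$; Player I wins iff $\{n_k : k \in \omega\} \in \mathcal{I}$. Let $\Delta = \{(m,n) \in \omega^2 : n \le m\}$; $\mathcal{ED}$ is the ideal on $\omega\times\omega$ generated by vertical lines $\{m\}\times\omega$ and graphs of functions $\omega\to\omega$, and $\mathcal{ED}_{\mathrm{fin}} = \{A \cap \Delta : A \in \mathcal{ED}\}$, an ideal on $\Delta$. For ideals $\mathcal{J}$ on $X$ and $\mathcal{I}$ on $Y$, $\mathcal{J} \le_{\mathrm{KB}} \mathcal{I}$ means there is a finite-to-one $f \colon Y \to X$ with $f^{ -1}(J) \in \mathcal{I}$ for all $J \in \mathcal{J}$. -}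

module Defs where

open import Level using (0ℓ)
open import Data.Nat using (ℕ; zero; suc; _≤_; _<_)
open import Data.Bool using (Bool; true; false)
open import Data.Product using (Σ; ∃; _×_; _,_; proj₁; proj₂)
open import Data.Sum using (_⊎_)
open import Data.Unit using (⊤)
open import Data.List using (List; []; _∷_)
open import Data.List.Membership.Propositional using (_∈_)
open import Data.List.Relation.Unary.Any using (Any)
open import Relation.Nullary using (¬_)
open import Relation.Unary using (Pred; _⊆_; _∪_)
open import Relation.Binary.PropositionalEquality using (_≡_)

Subset : Set → Set₁
Subset X = Pred X 0ℓ

Family : Set → Set₁
Family X = Pred (Subset X) 0ℓ

Finite : {X : Set} → Subset X → Set
Finite {X} A = Σ (List X) λ xs → ∀ x → A x → x ∈ xs

Infinite : {X : Set} → Subset X → Set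
Infinite A = ¬ Finite A

record IsIdeal {X : Set} (I : Family X) : Set₁ where
  field
    finite⊆ : ∀ A → Finite A → I A
    down    : ∀ A B → A ⊆ B → I B → I A
    union   : ∀ A B → I A → I B → I (A ∪ B)
    proper  : ¬ I (λ _ → ⊤)

-- Finite history of a play: hist f k = [f (k-1), ..., f 1, f 0]
-- (the moves made in rounds 0,...,k-1, most recent first).
hist : {A : Set} → (ℕ → A) → ℕ → List A
hist f zero    = []
hist f (suc k) = f k ∷ hist f k

StrictlyIncreasing : (ℕ → ℕ) → Set
StrictlyIncreasing n = ∀ k → n k < n (suc k)

-- A strategy for Player II assigns to the
-- sequence n_0,...,n_k of Player I's moves so far (the earlier moves of
-- II are determined by the strategy) the answer i_k ∈ {0,1}
-- (false = 0, true = 1).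

TallStrategyII : Set
TallStrategyII = List ℕ → Bool

tallSelected : TallStrategyII → (ℕ → ℕ) → Subset ℕ
tallSelected σ n m = ∃ λ k → n k ≡ m × σ (hist n (suc k)) ≡ true

IIWinsTallness : Family ℕ → Set
IIWinsTallness I = Σ TallStrategyII λ σ →
  ∀ (n : ℕ → ℕ) → StrictlyIncreasing n →
    Infinite (tallSelected σ n) × I (tallSelected σ n)

-- HMM game w.r.t. I.  A strategy for Player I assigns to the moves
-- n_0,...,n_{k-1} of Player II so far a finite set F_k ⊆ ω (a list).

HMMStrategyI : Set
HMMStrategyI = List ℕ → List ℕ

hmmRange : (ℕ → ℕ) → Subset ℕ
hmmRange n m = ∃ λ k → n k ≡ m

IWinsHMM : Family ℕ → Set
IWinsHMM I = Σ HMMStrategyI λ τ →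
  ∀ (n : ℕ → ℕ) → (∀ k → ¬ (n k ∈ τ (hist n k))) → I (hmmRange n)

ED : Family (ℕ × ℕ)
ED A = Σ (List ℕ) λ cols → Σ (List (ℕ → ℕ)) λ gs →
  ∀ m k → A (m , k) → (m ∈ cols) ⊎ Any (λ g → g m ≡ k) gs

Δ : Set
Δ = Σ (ℕ × ℕ) λ p → proj₂ p ≤ proj₁ p

-- ED_fin = {A ∩ Δ : A ∈ ED}, an ideal on Δ.  B ⊆ Δ is of the form A ∩ Δ
-- with A ∈ ED iff B itself (viewed as a subset of ω×ω) is in ED
-- (take A = B; conversely B = A ∩ Δ ⊆ A and ED is closed under subsets).
-- We use this form to avoid quantifying over subsets (a size issue).
asSubsetOfω² : Subset Δ → Subset (ℕ × ℕ)
asSubsetOfω² B p = Σ (proj₂ p ≤ proj₁ p) λ h → B (p , h)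

EDfin : Family Δ
EDfin B = ED (asSubsetOfω² B)

FiniteToOne : {X Y : Set} → (Y → X) → Set
FiniteToOne {X} f = ∀ (x : X) → Finite (λ y → f y ≡ x)

_≤KB_ : {X Y : Set} → Family X → Family Y → Set₁
_≤KB_ {X} {Y} J I = Σ (Y → X) λ f → FiniteToOne f ×
  (∀ (B : Subset X) → J B → I (λ y → B (f y)))

-- (3) ⇒ (1): if f witnesses ED_fin ≤KB I, Player I forbids every point whose f-image lies in a
-- column already visited.  The f-images of II's moves then lie in pairwise distinct columns, so
-- they form a partial graph, which is in ED_fin.
-- (1) ⇒ (2): Player II answers 1 exactly to the moves that are legal replies to I's HMM strategy
-- against the moves answered 1 so far.  These moves form a play of the HMM game lost by II.
-- (2) ⇒ (3): by excluded middle, a winning σ makes every large enough move t good after a fixed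
-- history (Player I can reach t legally so that σ answers 1 at t), and uniformly so for the
-- finitely many histories below N.  Choose mark 0 < mark 1 < ... outgrowing these bounds and send
-- y ∈ [mark c, mark (c + 1)) to (mark (c + 1), y).  The preimage of the graph of g is then covered
-- by the moves selected by σ in two plays of I that aim at g (mark (c + 2)) for every other c.

module Submission where

open import Defs
open import Level using (0ℓ; lift; lower)
open import Axiom.ExcludedMiddle using (ExcludedMiddle)
open import Function using (_∘_)
open import Function.Bundles using (_⇔_; mk⇔)
open import Data.Empty using (⊥; ⊥-elim)
open import Data.Bool using (true; false; if_then_else_)
open import Data.Product using (Σ; ∃; ∃₂; _,_; proj₁; proj₂; _×_)
open import Data.Sum using (_⊎_; inj₁; inj₂)
open import Data.Nat using (ℕ; zero; suc; _+_; _∸_; _⊔_; _≤_; _<_; _>_; z≤n; s≤s; s≤s⁻¹; _≟_; _≤?_; _<?_)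
open import Data.Nat.Properties
open import Data.Fin using (toℕ; fromℕ<)
open import Data.Fin.Properties using (toℕ≤pred[n]; toℕ-fromℕ<)
open import Data.List using (List; []; _∷_; _++_; _∷ʳ_; _ʳ++_; reverse; map; concatMap; upTo; allFin)
open import Data.List.Properties using (++-identityʳ; ∷-injectiveʳ; ++-ʳ++; ʳ++-ʳ++; ʳ++-defn)
open import Data.List.NonEmpty using (List⁺; _∷_; toList; head; tail) renaming (_∷ʳ_ to _∷ʳ⁺_)
open import Data.List.Extrema.Nat using (max; xs≤max)
open import Data.List.Membership.Propositional using (_∈_; _∉_)
open import Data.List.Membership.Propositional.Properties
  using (∈-++⁺ˡ; ∈-++⁺ʳ; ∈-map⁺; ∈-upTo⁺; ∈-allFin; ∈-concat⁺′)
open import Data.List.Membership.DecPropositional _≟_ using (_∈?_; _∉?_)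
open import Data.List.Relation.Unary.All as All using ()
open import Data.List.Relation.Unary.Any using (Any; here; there)
open import Data.List.Relation.Unary.Linked using (Linked; []; [-]; _∷_)
import Data.List.Relation.Unary.Linked as Linked
open import Relation.Nullary using (¬_; Dec; yes; no; does; contradiction)
open import Relation.Nullary.Decidable using (map′; decidable-stable; dec-true; dec-false; _×-dec_)
open import Relation.Unary using (Decidable; _⊆_; _∪_)
open import Relation.Binary.PropositionalEquality using (_≡_; _≢_; refl; sym; trans; cong; subst; module ≡-Reasoning)
open import Relation.Binary.Definitions using (tri<; tri≈; tri>)

∈⇒≤max : ∀ {x xs} → x ∈ xs → x ≤ max 0 xs
∈⇒≤max {xs = xs} = All.lookup (xs≤max 0 xs)

StrictlyIncreasing⇒≥id : ∀ {n} → StrictlyIncreasing n → ∀ k → k ≤ n k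
StrictlyIncreasing⇒≥id si zero    = z≤n
StrictlyIncreasing⇒≥id si (suc k) = ≤-<-trans (StrictlyIncreasing⇒≥id si k) (si k)

unbounded⇒infinite : ∀ {A : Subset ℕ} (m : ℕ → ℕ) → (∀ j → j ≤ m j) → (∀ j → A (m j)) → Infinite A
unbounded⇒infinite m m≥id Am (xs , xs⊇A) =
  <⇒≱ (≤-refl {suc (max 0 xs)}) (≤-trans (m≥id _) (∈⇒≤max (xs⊇A _ (Am (suc (max 0 xs))))))

∈-hist : ∀ {A : Set} (f : ℕ → A) {j k} → j < k → f j ∈ hist f k
∈-hist f {j} {suc k} j<1+k with m≤n⇒m<n∨m≡n (s≤s⁻¹ j<1+k)
... | inj₁ j<k  = there (∈-hist f j<k)
... | inj₂ refl = here refl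

tallSelected-hist : ∀ {σ n k m H} → hist n k ≡ m ∷ H → σ (m ∷ H) ≡ true → tallSelected σ n m
tallSelected-hist {σ} {k = suc k} refl σ≡true = k , refl , σ≡true

leastAbove : ∀ {P : ℕ → Set} → Decidable P → ∀ {k i} → k ≤ i → P i →
             ∃ λ k′ → k ≤ k′ × P k′ × (∀ j → k ≤ j → j < k′ → ¬ P j)
leastAbove {P} P? {k} {i} k≤i Pi = go (i ∸ k) k (subst P (sym (m∸n+n≡m k≤i)) Pi)
  where
  go : ∀ d k → P (d + k) → ∃ λ k′ → k ≤ k′ × P k′ × (∀ j → k ≤ j → j < k′ → ¬ P j)
  go d k Pd+k with P? k
  ... | yes Pk = k , ≤-refl , Pk , λ j k≤j j<k → contradiction (≤-<-trans k≤j j<k) (<-irrefl refl)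
  go zero k Pk | no ¬Pk = contradiction Pk ¬Pk
  go (suc d) k Pd+k | no ¬Pk with go d (suc k) (subst P (sym (+-suc d k)) Pd+k)
  ... | k′ , k<k′ , Pk′ , below = k′ , <⇒≤ k<k′ , Pk′ , below′
    where
    below′ : ∀ j → k ≤ j → j < k′ → ¬ P j
    below′ j k≤j j<k′ with k ≟ j
    ... | yes refl = ¬Pk
    ... | no k≢j   = below j (≤∧≢⇒< k≤j k≢j) j<k′

opaque
  firstAvoiding : ∀ {n} → StrictlyIncreasing n → (F : List ℕ) (k : ℕ) →
                  ∃ λ k′ → k ≤ k′ × n k′ ∉ F × (∀ j → k ≤ j → j < k′ → n j ∈ F)
  firstAvoiding {n} si F k with leastAbove (λ j → n j ∉? F) (m≤n+m k (suc (max 0 F))) n∉F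
    where
    n∉F : n (suc (max 0 F) + k) ∉ F
    n∉F n∈F = <⇒≱ (≤-trans (m≤m+n (suc (max 0 F)) k) (StrictlyIncreasing⇒≥id si _)) (∈⇒≤max n∈F)
  ... | k′ , k≤k′ , n∉F , below =
    k′ , k≤k′ , n∉F , λ j k≤j j<k′ → decidable-stable (n j ∈? F) (below j k≤j j<k′)

module Segments (next : ℕ → ℕ) (next≥ : ∀ k → k ≤ next k) where

  start : ℕ → ℕ
  start zero    = 0
  start (suc j) = suc (next (start j))

  start≥id : ∀ j → j ≤ start j
  start≥id zero    = z≤n
  start≥id (suc j) = s≤s (≤-trans (start≥id j) (next≥ (start j)))

  segments-cover : ∀ k → ∃ λ j → start j ≤ k × k ≤ next (start j)
  segments-cover zero = 0 , z≤n , z≤n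
  segments-cover (suc k) with segments-cover k
  ... | j , s≤k , k≤next with m≤n⇒m<n∨m≡n k≤next
  ...   | inj₁ k<next = j , m≤n⇒m≤1+n s≤k , k<next
  ...   | inj₂ refl   = suc j , ≤-refl , next≥ (suc k)

finiteUnion-∈ : ∀ {X} {I : Family X} → IsIdeal I → {G : Set} (P : G → Subset X) → (∀ g → I (P g)) →
                ∀ gs → I (λ x → Any (λ g → P g x) gs)
finiteUnion-∈ isI P P∈I []       = IsIdeal.finite⊆ isI _ ([] , λ _ ())
finiteUnion-∈ isI P P∈I (g ∷ gs) =
  IsIdeal.down isI _ _ split (IsIdeal.union isI _ _ (P∈I g) (finiteUnion-∈ isI P P∈I gs))
  where
  split : (λ x → Any (λ g → P g x) (g ∷ gs)) ⊆ (P g ∪ (λ x → Any (λ g → P g x) gs))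
  split (here Pgx)   = inj₁ Pgx
  split (there Pgsx) = inj₂ Pgsx

initialSegment-∈ : ∀ {I} → IsIdeal I → ∀ N → I (_< N)
initialSegment-∈ isI N = IsIdeal.finite⊆ isI _ (upTo N , λ _ → ∈-upTo⁺)

module _ {X Y : Set} {f : Y → X} (f-fto : FiniteToOne f) where

  preimage : List X → List Y
  preimage = concatMap (λ x → proj₁ (f-fto x))

  ∈-preimage : ∀ {y xs} → f y ∈ xs → y ∈ preimage xs
  ∈-preimage {y} fy∈xs = ∈-concat⁺′ (proj₂ (f-fto (f y)) y refl) (∈-map⁺ _ fy∈xs)

  FiniteToOne-∘ : ∀ {Z} {g : X → Z} → FiniteToOne g → FiniteToOne (g ∘ f)
  FiniteToOne-∘ g-fto z = preimage (proj₁ (g-fto z)) , λ y gfy≡z → ∈-preimage (proj₂ (g-fto z) (f y) gfy≡z)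

Δ-≡ : {d d′ : Δ} → proj₁ d ≡ proj₁ d′ → d ≡ d′
Δ-≡ {p , _} refl = cong (p ,_) (≤-irrelevant _ _)

Δ-column : ℕ → List Δ
Δ-column m = map (λ i → (m , toℕ i) , toℕ≤pred[n] i) (allFin (suc m))

∈-Δ-column : ∀ {m k} (k≤m : k ≤ m) → ((m , k) , k≤m) ∈ Δ-column m
∈-Δ-column {m} k≤m =
  subst (_∈ Δ-column m) (Δ-≡ (cong (m ,_) (toℕ-fromℕ< (s≤s k≤m))))
    (∈-map⁺ _ (∈-allFin (fromℕ< (s≤s k≤m))))

Δ-column-finiteToOne : FiniteToOne {ℕ} {Δ} (proj₁ ∘ proj₁)
Δ-column-finiteToOne m = Δ-column m , λ { ((_ , _) , k≤m) refl → ∈-Δ-column k≤m }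

module Classical (lem : ExcludedMiddle (Level.suc 0ℓ)) where

  decide : (P : Set) → Dec P
  decide P = map′ lower lift lem

  ¬∀⇒∃¬ : {A : Set} {P : A → Set} → ¬ (∀ x → P x) → ∃ λ x → ¬ P x
  ¬∀⇒∃¬ {A} {P} ¬∀P with decide (∃ λ x → ¬ P x)
  ... | yes ∃¬P = ∃¬P
  ... | no ¬∃¬P = ⊥-elim (¬∀P λ x → decidable-stable (decide (P x)) λ ¬Px → ¬∃¬P (x , ¬Px))

  ED-singleValued : (A : Subset (ℕ × ℕ)) → (∀ {m k k′} → A (m , k) → A (m , k′) → k ≡ k′) → ED A
  ED-singleValued A single = [] , value ∷ [] , λ m k Amk → inj₂ (here (value-correct m k Amk (decide _)))
    where
    valueOf : ∀ m → Dec (∃ λ k → A (m , k)) → ℕ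
    valueOf m (yes (k , _)) = k
    valueOf m (no _)        = 0

    value : ℕ → ℕ
    value m = valueOf m (decide _)

    value-correct : ∀ m k → A (m , k) → (D : Dec (∃ λ k → A (m , k))) → valueOf m D ≡ k
    value-correct m k Amk (yes (k′ , Amk′)) = single Amk′ Amk
    value-correct m k Amk (no ¬∃)           = contradiction (k , Amk) ¬∃

-- (3) ⇒ (1)

module _ (lem : ExcludedMiddle (Level.suc 0ℓ)) {I : Family ℕ} (isI : IsIdeal I) where
  open Classical lem

  KB⇒IWinsHMM : EDfin ≤KB I → IWinsHMM I
  KB⇒IWinsHMM (f , f-fto , f⁻¹-ED) = strategy , λ n legal →
    IsIdeal.down isI _ _ (λ { (k , refl) → k , refl }) (f⁻¹-ED _ (ED-singleValued _ (singleValued n legal)))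
    where
    column : ℕ → ℕ
    column = proj₁ ∘ proj₁ ∘ f

    column-fto : FiniteToOne column
    column-fto = FiniteToOne-∘ f-fto Δ-column-finiteToOne

    strategy : HMMStrategyI
    strategy L = preimage column-fto (map column L)

    sameColumn⇒∈ : ∀ {y y′ L} → y ∈ L → column y′ ≡ column y → y′ ∈ strategy L
    sameColumn⇒∈ {L = L} y∈L same = ∈-preimage column-fto (subst (_∈ map column L) (sym same) (∈-map⁺ column y∈L))

    distinctColumns : ∀ n → (∀ k → n k ∉ strategy (hist n k)) →
                      ∀ i j → column (n i) ≡ column (n j) → n i ≡ n j
    distinctColumns n legal i j same with <-cmp i j
    ... | tri< i<j _ _ = contradiction (sameColumn⇒∈ (∈-hist n i<j) (sym same)) (legal j)
    ... | tri≈ _ refl _ = refl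
    ... | tri> _ _ j<i = contradiction (sameColumn⇒∈ (∈-hist n j<i) same) (legal i)

    singleValued : ∀ n → (∀ k → n k ∉ strategy (hist n k)) → ∀ {m k k′} →
                   asSubsetOfω² (λ d → ∃ λ i → f (n i) ≡ d) (m , k) →
                   asSubsetOfω² (λ d → ∃ λ i → f (n i) ≡ d) (m , k′) → k ≡ k′
    singleValued n legal (_ , i , fni≡) (_ , j , fnj≡) =
      cong (proj₂ ∘ proj₁) (trans (sym fni≡) (trans (cong f ni≡nj) fnj≡))
      where
      ni≡nj : n i ≡ n j
      ni≡nj = distinctColumns n legal i j (trans (cong (proj₁ ∘ proj₁) fni≡) (cong (proj₁ ∘ proj₁) (sym fnj≡)))

-- (1) ⇒ (2)

module _ (τ : HMMStrategyI) where

  answer : TallStrategyII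
  accepted : List ℕ → List ℕ

  answer []      = false
  answer (x ∷ H) = does (x ∉? τ (accepted H))

  accepted []      = []
  accepted (x ∷ H) = if answer (x ∷ H) then x ∷ accepted H else accepted H

  answer-true⇒∉ : ∀ {x} H → answer (x ∷ H) ≡ true → x ∉ τ (accepted H)
  answer-true⇒∉ {x} H answer≡true x∈ =
    contradiction (trans (sym answer≡true) (dec-false (x ∉? τ (accepted H)) (λ x∉ → x∉ x∈))) λ ()

  accepted-∈ : ∀ {x} H → x ∈ τ (accepted H) → accepted (x ∷ H) ≡ accepted H
  accepted-∈ {x} H x∈ rewrite dec-false (x ∉? τ (accepted H)) (λ x∉ → x∉ x∈) = refl

  accepted-∉ : ∀ {x} H → x ∉ τ (accepted H) → accepted (x ∷ H) ≡ x ∷ accepted H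
  accepted-∉ {x} H x∉ rewrite dec-true (x ∉? τ (accepted H)) x∉ = refl

  module _ {n : ℕ → ℕ} (si : StrictlyIncreasing n) where

    acceptedUpTo : ℕ → List ℕ
    acceptedUpTo k = accepted (hist n k)

    nextAccepted : ℕ → ℕ
    nextAccepted k = proj₁ (firstAvoiding si (τ (acceptedUpTo k)) k)

    nextAccepted≥ : ∀ k → k ≤ nextAccepted k
    nextAccepted≥ k = proj₁ (proj₂ (firstAvoiding si (τ (acceptedUpTo k)) k))

    nextAccepted-∉ : ∀ k → n (nextAccepted k) ∉ τ (acceptedUpTo k)
    nextAccepted-∉ k = proj₁ (proj₂ (proj₂ (firstAvoiding si (τ (acceptedUpTo k)) k)))

    rejectedBefore : ∀ k j → k ≤ j → j < nextAccepted k → n j ∈ τ (acceptedUpTo k)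
    rejectedBefore k = proj₂ (proj₂ (proj₂ (firstAvoiding si (τ (acceptedUpTo k)) k)))

    acceptedUpTo-stable : ∀ k j → k ≤ j → j ≤ nextAccepted k → acceptedUpTo j ≡ acceptedUpTo k
    acceptedUpTo-stable k j k≤j j≤next with m≤n⇒m<n∨m≡n k≤j
    ... | inj₂ refl = refl
    acceptedUpTo-stable k (suc j) _ j<next | inj₁ k<1+j =
      trans (accepted-∈ (hist n j) (subst (λ L → n j ∈ τ L) (sym IH) (rejectedBefore k j k≤j j<next))) IH
      where
      k≤j : k ≤ j
      k≤j = s≤s⁻¹ k<1+j

      IH : acceptedUpTo j ≡ acceptedUpTo k
      IH = acceptedUpTo-stable k j k≤j (<⇒≤ j<next)

    acceptedAt-next : ∀ k → n (nextAccepted k) ∉ τ (acceptedUpTo (nextAccepted k))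
    acceptedAt-next k = subst (λ L → n (nextAccepted k) ∉ τ L)
      (sym (acceptedUpTo-stable k (nextAccepted k) (nextAccepted≥ k) ≤-refl)) (nextAccepted-∉ k)

    open Segments nextAccepted nextAccepted≥

    acceptedMove : ℕ → ℕ
    acceptedMove j = n (nextAccepted (start j))

    acceptedUpTo-start : ∀ j → acceptedUpTo (start j) ≡ hist acceptedMove j
    acceptedUpTo-start zero    = refl
    acceptedUpTo-start (suc j) = begin
      accepted (n p ∷ hist n p)      ≡⟨ accepted-∉ (hist n p) (acceptedAt-next (start j)) ⟩
      n p ∷ acceptedUpTo p           ≡⟨ cong (n p ∷_) (trans stable (acceptedUpTo-start j)) ⟩
      acceptedMove j ∷ hist acceptedMove j ∎
      where
      open ≡-Reasoning
      p : ℕ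
      p = nextAccepted (start j)

      stable : acceptedUpTo p ≡ acceptedUpTo (start j)
      stable = acceptedUpTo-stable (start j) p (nextAccepted≥ (start j)) ≤-refl

    acceptedMove-legal : ∀ j → acceptedMove j ∉ τ (hist acceptedMove j)
    acceptedMove-legal j = subst (λ L → acceptedMove j ∉ τ L) (acceptedUpTo-start j) (nextAccepted-∉ (start j))

    acceptedMove-selected : ∀ j → tallSelected answer n (acceptedMove j)
    acceptedMove-selected j = p , refl , dec-true (n p ∉? τ (acceptedUpTo p)) (acceptedAt-next (start j))
      where
      p : ℕ
      p = nextAccepted (start j)

    selected⊆acceptedMoves : tallSelected answer n ⊆ hmmRange acceptedMove
    selected⊆acceptedMoves (k , refl , answer≡true) with segments-cover k
    ... | j , start≤k , k≤next with m≤n⇒m<n∨m≡n k≤next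
    ...   | inj₂ refl   = j , refl
    ...   | inj₁ k<next = contradiction (rejectedBefore (start j) k start≤k k<next) nk∉
      where
      nk∉ : n k ∉ τ (acceptedUpTo (start j))
      nk∉ = subst (λ L → n k ∉ τ L) (acceptedUpTo-stable (start j) k start≤k k≤next)
              (answer-true⇒∉ (hist n k) answer≡true)

    selected-infinite : Infinite (tallSelected answer n)
    selected-infinite = unbounded⇒infinite acceptedMove
      (λ j → ≤-trans (≤-trans (start≥id j) (nextAccepted≥ (start j))) (StrictlyIncreasing⇒≥id si _))
      acceptedMove-selected

IWinsHMM⇒IIWinsTallness : ∀ {I} → IsIdeal I → IWinsHMM I → IIWinsTallness I
IWinsHMM⇒IIWinsTallness isI (τ , τ-wins) = answer τ , λ n si →
  selected-infinite τ si ,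
  IsIdeal.down isI _ _ (selected⊆acceptedMoves τ si) (τ-wins (acceptedMove τ si) (acceptedMove-legal τ si))

Decreasing : List ℕ → Set
Decreasing = Linked _>_

top : List ℕ → ℕ
top []      = 0
top (x ∷ _) = x

decreasing-∷ : ∀ {x H} → Decreasing H → top H < x → Decreasing (x ∷ H)
decreasing-∷ []        _     = [-]
decreasing-∷ [-]       top<x = top<x ∷ [-]
decreasing-∷ (y>z ∷ H) top<x = top<x ∷ y>z ∷ H

decreasing-++⁻ʳ : ∀ P {H} → Decreasing (P ++ H) → Decreasing H
decreasing-++⁻ʳ []      d = d
decreasing-++⁻ʳ (x ∷ P) d = decreasing-++⁻ʳ P (Linked.tail d)

decreasingBelow : ℕ → List (List ℕ)
decreasingBelow zero    = [] ∷ []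
decreasingBelow (suc N) = decreasingBelow N ++ map (N ∷_) (decreasingBelow N)

∈-decreasingBelow : ∀ {N H} → Decreasing (N ∷ H) → H ∈ decreasingBelow N
∈-decreasingBelow {zero}  [-]        = here refl
∈-decreasingBelow {suc N} [-]        = ∈-++⁺ˡ (∈-decreasingBelow {N} [-])
∈-decreasingBelow {suc N} {x ∷ H} (x<1+N ∷ d) with m≤n⇒m<n∨m≡n (s≤s⁻¹ x<1+N)
... | inj₁ x<N  = ∈-++⁺ˡ (∈-decreasingBelow (x<N ∷ d))
... | inj₂ refl = ∈-++⁺ʳ (decreasingBelow x) (∈-map⁺ (x ∷_) (∈-decreasingBelow d))

-- Block j lists its moves most recent first, so after it the history is  toList (block j) ++ stack j.
module BlockPlay (block : ℕ → List⁺ ℕ) where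

  stack : ℕ → List ℕ
  stack zero    = []
  stack (suc j) = toList (block j) ++ stack j

  -- pending: the rest of the current block, in order of play.
  record Stage : Set where
    constructor stage
    field
      pending : List ℕ
      begun   : ℕ
  open Stage

  inPlayOrder : List⁺ ℕ → List⁺ ℕ
  inPlayOrder (t ∷ q) = reverse q ∷ʳ⁺ t

  advance : Stage → ℕ × Stage
  advance (stage (x ∷ xs) j) = x , stage xs j
  advance (stage []       j) = head (inPlayOrder (block j)) , stage (tail (inPlayOrder (block j))) (suc j)

  stages : ℕ → Stage
  stages zero    = stage [] 0
  stages (suc k) = proj₂ (advance (stages k))

  moves : ℕ → ℕ
  moves k = proj₁ (advance (stages k))

  toList-∷ʳ⁺ : ∀ (xs : List ℕ) t → toList (xs ∷ʳ⁺ t) ≡ xs ∷ʳ t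
  toList-∷ʳ⁺ []      t = refl
  toList-∷ʳ⁺ (x ∷ xs) t = refl

  inPlayOrder-ʳ++ : ∀ B S → toList (inPlayOrder B) ʳ++ S ≡ toList B ++ S
  inPlayOrder-ʳ++ (t ∷ q) S = begin
    toList (reverse q ∷ʳ⁺ t) ʳ++ S   ≡⟨ cong (_ʳ++ S) (toList-∷ʳ⁺ (reverse q) t) ⟩
    (reverse q ++ t ∷ []) ʳ++ S      ≡⟨ ++-ʳ++ (reverse q) ⟩
    t ∷ (reverse q ʳ++ S)            ≡⟨ cong (t ∷_) (ʳ++-ʳ++ q) ⟩
    t ∷ q ++ S                       ∎
    where open ≡-Reasoning

  advance-invariant : ∀ s H → pending s ʳ++ H ≡ stack (begun s) →
                      pending (proj₂ (advance s)) ʳ++ (proj₁ (advance s) ∷ H) ≡ stack (begun (proj₂ (advance s)))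
  advance-invariant (stage (x ∷ xs) j) H inv = inv
  advance-invariant (stage []       j) H refl = inPlayOrder-ʳ++ (block j) H

  pending-ʳ++-history : ∀ k → pending (stages k) ʳ++ hist moves k ≡ stack (begun (stages k))
  pending-ʳ++-history zero    = refl
  pending-ʳ++-history (suc k) = advance-invariant (stages k) (hist moves k) (pending-ʳ++-history k)

  history-suffix : ∀ k → ∃₂ λ j P → P ++ hist moves k ≡ stack j
  history-suffix k = begun (stages k) , reverse (pending (stages k)) ,
    trans (sym (ʳ++-defn (pending (stages k)))) (pending-ʳ++-history k)

  flush : ∀ {k j} P → stages k ≡ stage P j → ∃ λ k′ → stages k′ ≡ stage [] j
  flush {k} []       eq = k , eq
  flush {k} (x ∷ xs) eq = flush {suc k} xs (cong (proj₂ ∘ advance) eq)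

  reaches-begin : ∀ j → ∃ λ k → stages k ≡ stage [] j
  reaches-begin zero    = 0 , refl
  reaches-begin (suc j) with reaches-begin j
  ... | k , eq = flush {suc k} (tail (inPlayOrder (block j))) (cong (proj₂ ∘ advance) eq)

  reaches-stack : ∀ j → ∃ λ k → hist moves k ≡ stack j
  reaches-stack j with reaches-begin j
  ... | k , eq = k , subst (λ s → pending s ʳ++ hist moves k ≡ stack (begun s)) eq (pending-ʳ++-history k)

  moves-increasing : (∀ j → Decreasing (stack j)) → StrictlyIncreasing moves
  moves-increasing d k with history-suffix (suc (suc k))
  ... | j , P , eq = Linked.head (decreasing-++⁻ʳ P (subst Decreasing (sym eq) (d j)))

module Intervals (e : ℕ → ℕ) (e-inc : StrictlyIncreasing e) (e0≡0 : e 0 ≡ 0) where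

  interval : ℕ → ℕ
  interval zero = 0
  interval (suc y) with suc y <? e (suc (interval y))
  ... | yes _ = interval y
  ... | no  _ = suc (interval y)

  interval-spec : ∀ y → e (interval y) ≤ y × y < e (suc (interval y))
  interval-spec zero = ≤-reflexive e0≡0 , subst (_< e 1) e0≡0 (e-inc 0)
  interval-spec (suc y) with suc y <? e (suc (interval y)) | interval-spec y
  ... | yes y+1<e | e≤y , _   = m≤n⇒m≤1+n e≤y , y+1<e
  ... | no  y+1≮e | _   , y<e = ≮⇒≥ y+1≮e , ≤-<-trans y<e (e-inc _)

opaque
  clamp : ℕ → ℕ → ℕ → ℕ
  clamp lo hi x with lo ≤? x ×-dec x <? hi
  ... | yes _ = x
  ... | no  _ = lo

  clamp-range : ∀ {lo hi} x → lo < hi → lo ≤ clamp lo hi x × clamp lo hi x < hi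
  clamp-range {lo} {hi} x lo<hi with lo ≤? x ×-dec x <? hi
  ... | yes inRange = inRange
  ... | no  _       = ≤-refl , lo<hi

  clamp-id : ∀ {lo hi x} → lo ≤ x → x < hi → clamp lo hi x ≡ x
  clamp-id {lo} {hi} {x} lo≤x x<hi with lo ≤? x ×-dec x <? hi
  ... | yes _        = refl
  ... | no  ¬inRange = contradiction (lo≤x , x<hi) ¬inRange

_+2*_ : ℕ → ℕ → ℕ
p +2* zero  = p
p +2* suc j = suc (suc (p +2* j))

suc-+2* : ∀ p j → suc (p +2* j) ≡ suc p +2* j
suc-+2* p zero    = refl
suc-+2* p (suc j) = cong (suc ∘ suc) (suc-+2* p j)

even-or-odd : ∀ c → ∃ λ j → c ≡ 0 +2* j ⊎ c ≡ 1 +2* j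
even-or-odd zero = 0 , inj₁ refl
even-or-odd (suc c) with even-or-odd c
... | j , inj₁ refl = j , inj₂ (suc-+2* 0 j)
... | j , inj₂ refl = suc j , inj₁ (cong suc (sym (suc-+2* 0 j)))

-- (2) ⇒ (3)

module _ (lem : ExcludedMiddle (Level.suc 0ℓ)) {I : Family ℕ} (isI : IsIdeal I)
         (σ : TallStrategyII)
         (σ-wins : ∀ n → StrictlyIncreasing n → Infinite (tallSelected σ n) × I (tallSelected σ n)) where
  open Classical lem

  Good : List ℕ → ℕ → Set
  Good H t = ∃ λ q → Decreasing (t ∷ q ++ H) × σ (t ∷ q ++ H) ≡ true

  -- If arbitrarily large bad moves existed, Player I could play H and then only bad moves,
  -- and σ would answer 1 only finitely often.
  module _ {H} (dec-H : Decreasing H) (bad : ℕ → ℕ) (bad> : ∀ b → b < bad b)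
           (bad-¬good : ∀ b → ¬ Good H (bad b)) where

    badMove : ℕ → ℕ
    badMove zero    = bad (top H)
    badMove (suc i) = bad (badMove i)

    badMoves : ℕ → List ℕ
    badMoves zero    = []
    badMoves (suc i) = badMove i ∷ badMoves i

    badBlock : ℕ → List⁺ ℕ
    badBlock zero    = badMove zero ∷ H
    badBlock (suc i) = badMove (suc i) ∷ []

    open BlockPlay badBlock

    stack-suc : ∀ i → stack (suc i) ≡ badMove i ∷ badMoves i ++ H
    stack-suc zero    = cong (badMove zero ∷_) (++-identityʳ H)
    stack-suc (suc i) = cong (badMove (suc i) ∷_) (stack-suc i)

    decreasing-badMoves : ∀ i → Decreasing (badMove i ∷ badMoves i ++ H)
    decreasing-badMoves zero    = decreasing-∷ dec-H (bad> (top H))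
    decreasing-badMoves (suc i) = bad> (badMove i) ∷ decreasing-badMoves i

    stack-decreasing : ∀ j → Decreasing (stack j)
    stack-decreasing zero    = []
    stack-decreasing (suc i) = subst Decreasing (sym (stack-suc i)) (decreasing-badMoves i)

    stack-rejected : ∀ i → σ (stack (suc i)) ≢ true
    stack-rejected i σ≡true =
      badMove-¬good i (badMoves i , decreasing-badMoves i , subst (λ S → σ S ≡ true) (stack-suc i) σ≡true)
      where
      badMove-¬good : ∀ i → ¬ Good H (badMove i)
      badMove-¬good zero    = bad-¬good (top H)
      badMove-¬good (suc i) = bad-¬good (badMove i)

    selected∈H : ∀ j P {m S} → P ++ m ∷ S ≡ stack j → σ (m ∷ S) ≡ true → m ∈ H
    selected∈H zero          []      ()
    selected∈H zero          (_ ∷ _) ()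
    selected∈H (suc i)       []      refl σ≡true = contradiction σ≡true (stack-rejected i)
    selected∈H (suc zero)    (x ∷ P) eq   _       =
      subst (_ ∈_) (++-identityʳ H) (subst (_ ∈_) (∷-injectiveʳ eq) (∈-++⁺ʳ P (here refl)))
    selected∈H (suc (suc i)) (x ∷ P) eq   σ≡true = selected∈H (suc i) P (∷-injectiveʳ eq) σ≡true

    badSequence-absurd : ⊥
    badSequence-absurd = proj₁ (σ-wins moves (moves-increasing stack-decreasing)) (H , selected⊆H)
      where
      selected⊆H : ∀ m → tallSelected σ moves m → m ∈ H
      selected⊆H m (k , refl , σ≡true) with history-suffix (suc k)
      ... | j , P , eq = selected∈H j P eq σ≡true

  eventuallyGood : ∀ {H} → Decreasing H → ∃ λ b → ∀ t → b < t → Good H t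
  eventuallyGood {H} dec-H with decide (∃ λ b → ∀ t → b < t → Good H t)
  ... | yes ev = ev
  ... | no ¬ev =
    ⊥-elim (badSequence-absurd dec-H (proj₁ ∘ badAbove) (proj₁ ∘ proj₂ ∘ badAbove) (proj₂ ∘ proj₂ ∘ badAbove))
    where
    badAbove : ∀ b → ∃ λ t → b < t × ¬ Good H t
    badAbove b with ¬∀⇒∃¬ (λ goodAbove → ¬ev (b , goodAbove))
    ... | t , ¬[b<t⇒good] =
      t , decidable-stable (b <? t) (λ b≮t → ¬[b<t⇒good] (λ b<t → contradiction b<t b≮t)) ,
      λ good → ¬[b<t⇒good] (λ _ → good)

  threshold : (Hs : List (List ℕ)) → ∃ λ b → ∀ {H} → H ∈ Hs → Decreasing H → ∀ t → b < t → Good H t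
  threshold []       = 0 , λ ()
  threshold (H ∷ Hs) with Linked.linked? _>?_ H | threshold Hs
  ... | yes dec-H | b′ , good′ =
    let b , good = eventuallyGood dec-H in
    b ⊔ b′ , λ { (here refl) _ t b⊔b′<t → good t (m⊔n<o⇒m<o b b′ b⊔b′<t)
               ; (there H∈Hs) d t b⊔b′<t → good′ H∈Hs d t (m⊔n<o⇒n<o b b′ b⊔b′<t) }
  ... | no ¬dec-H | b′ , good′ =
    b′ , λ { (here refl) d → contradiction d ¬dec-H ; (there H∈Hs) → good′ H∈Hs }

  opaque
    bound : ℕ → ℕ
    bound N = proj₁ (threshold (decreasingBelow N))

    good-above-bound : ∀ {N H t} → Decreasing (N ∷ H) → bound N < t → Good H t
    good-above-bound d = proj₂ (threshold _) (∈-decreasingBelow d) (Linked.tail d) _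

  mark : ℕ → ℕ
  mark zero    = 0
  mark (suc c) = suc (bound (mark c) + mark c)

  mark-increasing : StrictlyIncreasing mark
  mark-increasing c = s≤s (m≤n+m (mark c) _)

  bound<mark : ∀ c → bound (mark c) < mark (suc c)
  bound<mark c = s≤s (m≤m+n _ (mark c))

  open Intervals mark mark-increasing refl

  column : ℕ → ℕ
  column y = mark (suc (interval y))

  toΔ : ℕ → Δ
  toΔ y = (column y , y) , <⇒≤ (proj₂ (interval-spec y))

  toΔ-finiteToOne : FiniteToOne toΔ
  toΔ-finiteToOne ((_ , k) , _) = k ∷ [] , λ { y refl → here refl }

  -- Block c may aim at any target c ≥ mark (c + 1) > bound (mark c) because the history before it
  -- lies below mark c; afterwards it lies below mark (c + 2), so a play serves every other block.
  module _ (g : ℕ → ℕ) where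

    target : ℕ → ℕ
    target c = clamp (mark (suc c)) (mark (suc (suc c))) (g (mark (suc (suc c))))

    target-range : ∀ c → mark (suc c) ≤ target c × target c < mark (suc (suc c))
    target-range c = clamp-range (g (mark (suc (suc c)))) (mark-increasing (suc c))

    HistoryBelow : ℕ → Set
    HistoryBelow N = Σ (List ℕ) λ H → Decreasing (N ∷ H)

    good-target : ∀ c (H : HistoryBelow (mark c)) → Good (proj₁ H) (target c)
    good-target c (_ , d) = good-above-bound d (<-≤-trans (bound<mark c) (proj₁ (target-range c)))

    targetBlock : ∀ c → HistoryBelow (mark c) → List⁺ ℕ
    targetBlock c H = target c ∷ proj₁ (good-target c H)

    afterTarget : ∀ c → HistoryBelow (mark c) → HistoryBelow (mark (suc (suc c)))
    afterTarget c H = toList (targetBlock c H) ++ proj₁ H , proj₂ (target-range c) ∷ proj₁ (proj₂ (good-target c H))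

    module _ (p : ℕ) where

      histories : ∀ j → HistoryBelow (mark (p +2* j))
      histories zero    = [] , [-]
      histories (suc j) = afterTarget (p +2* j) (histories j)

      open BlockPlay (λ j → targetBlock (p +2* j) (histories j))

      stack≡histories : ∀ j → stack j ≡ proj₁ (histories j)
      stack≡histories zero    = refl
      stack≡histories (suc j) = cong (toList (targetBlock (p +2* j) (histories j)) ++_) (stack≡histories j)

      targetPlay : ℕ → ℕ
      targetPlay = moves

      targetPlay-increasing : StrictlyIncreasing targetPlay
      targetPlay-increasing = moves-increasing λ j →
        subst Decreasing (sym (stack≡histories j)) (Linked.tail (proj₂ (histories j)))

      targetPlay-selects : ∀ j → tallSelected σ targetPlay (target (p +2* j))
      targetPlay-selects j with reaches-stack (suc j)
      ... | k , eq = tallSelected-hist {σ} (trans eq (stack≡histories (suc j)))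
                       (proj₂ (proj₂ (good-target (p +2* j) (histories j))))

    graph-∈ : I (λ y → g (column y) ≡ y)
    graph-∈ = IsIdeal.down isI _ _ onGraph
      (IsIdeal.union isI _ _ (initialSegment-∈ isI (mark 1))
        (IsIdeal.union isI _ _ (proj₂ (σ-wins _ (targetPlay-increasing 0))) (proj₂ (σ-wins _ (targetPlay-increasing 1)))))
      where
      onGraph : (λ y → g (column y) ≡ y) ⊆
                (_< mark 1) ∪ (tallSelected σ (targetPlay 0) ∪ tallSelected σ (targetPlay 1))
      onGraph {y} gy≡y with interval y | interval-spec y
      ... | zero  | _ , y<mark1 = inj₁ y<mark1
      ... | suc c | lo , hi with trans (cong (clamp (mark (suc c)) (mark (suc (suc c)))) gy≡y) (clamp-id lo hi) | even-or-odd c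
      ...   | target≡y | j , inj₁ refl = inj₂ (inj₁ (subst (tallSelected σ _) target≡y (targetPlay-selects 0 j)))
      ...   | target≡y | j , inj₂ refl = inj₂ (inj₂ (subst (tallSelected σ _) target≡y (targetPlay-selects 1 j)))

  toΔ-KB : EDfin ≤KB I
  toΔ-KB = toΔ , toΔ-finiteToOne , λ B (cols , gs , cover) →
    IsIdeal.down isI _ _ (covered cols gs cover)
      (IsIdeal.union isI _ _ (initialSegment-∈ isI (max 0 cols)) (finiteUnion-∈ isI _ graph-∈ gs))
    where
    covered : ∀ {B} cols gs → (∀ m k → asSubsetOfω² B (m , k) → m ∈ cols ⊎ Any (λ g → g m ≡ k) gs) →
              (λ y → B (toΔ y)) ⊆ (_< max 0 cols) ∪ (λ y → Any (λ g → g (column y) ≡ y) gs)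
    covered cols gs cover {y} B-toΔy with cover (column y) y (_ , B-toΔy)
    ... | inj₁ column∈cols = inj₁ (<-≤-trans (proj₂ (interval-spec y)) (∈⇒≤max column∈cols))
    ... | inj₂ onGraph     = inj₂ onGraph

IIWinsTallness⇒KB : ExcludedMiddle (Level.suc 0ℓ) → ∀ {I} → IsIdeal I → IIWinsTallness I → EDfin ≤KB I
IIWinsTallness⇒KB lem isI (σ , σ-wins) = toΔ-KB lem isI σ σ-wins


theorem6p6 : ExcludedMiddle (Level.suc 0ℓ) →
    (I : Family ℕ) → IsIdeal I →
      ((IWinsHMM I ⇔ IIWinsTallness I) × (IIWinsTallness I ⇔ (EDfin ≤KB I)))
theorem6p6 lem I isI =
  mk⇔ hmm⇒tallness (KB⇒hmm ∘ tallness⇒KB) , mk⇔ tallness⇒KB (hmm⇒tallness ∘ KB⇒hmm)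
  where
  hmm⇒tallness : IWinsHMM I → IIWinsTallness I
  hmm⇒tallness = IWinsHMM⇒IIWinsTallness isI

  tallness⇒KB : IIWinsTallness I → EDfin ≤KB I
  tallness⇒KB = IIWinsTallness⇒KB lem isI

  KB⇒hmm : EDfin ≤KB I → IWinsHMM I
  KB⇒hmm = KB⇒IWinsHMM lem isI
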